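{- Let $q$ be a prime power, $N\ge 3$, $1\le k\le N-1$, and $1 \le \ell \le (q^N-1)/(q-1)$ integers, and let $X$ be an $N$-dimensional $\mathbb{F}_q$-vector space. Then $$\hat{\delta}_q(N,k,\ell) = \binom{\frac{q^N-q^k}{q-1}}{\ell}\Big/\binom{\frac{q^N-1}{q-1}}{\ell}.$$
   Context: $\mathcal{G}_q(X,j)$ denotes the set of $j$-dimensional $\mathbb{F}_q$-subspaces of $X$. A point set is a nonempty subset $P\subseteq\mathcal{G}_q(X,1)$; a subspace $V\le X$ distinguishes $P$ if no element of $P$ is contained in $V$. $\delta_q(X,k,P)$ is the number of $V\in\mathcal{G}_q(X,k)$ distinguishing $P$, divided by $|\mathcal{G}_q(X,k)|$. $\hat\delta_q(N,k,\ell)$ is the average of $\delta_q(X,k,P)$ over all point sets $P\subseteq\mathcal{G}_q(X,1)$ with $|P|=\ell$ (i.e. the sum of $\delta_q(X,k,P)$ over these $P$, divided by $\binom{(q^N-1)/(q-1)}{\ell}$). -}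

module Defs where

open import Data.Nat as ℕ using (ℕ; zero; suc; _∸_; _^_; NonZero)
open import Data.Nat.DivMod using (_/_)
open import Data.Nat.Combinatorics using (_C_)
open import Data.Fin as Fin using (Fin)
open import Data.Vec as Vec using (Vec; []; _∷_)
open import Data.List as List using (List; []; _∷_; [_]; _++_; filterᵇ; length; concatMap)
open import Data.Bool.ListAction using (all; any)
open import Data.Bool using (Bool; true; false; _∧_; _∨_; not)
open import Data.Product using (Σ; _,_)
open import Data.Integer using (+_)
open import Data.Rational as ℚ using (ℚ; 0ℚ)
open import Relation.Nullary using (yes; no)
open import Relation.Nullary.Decidable using (⌊_⌋)
open import Relation.Binary.PropositionalEquality using (_≡_; _≢_; refl; cong; trans; sym)
open import Algebra.Structures using (IsCommutativeRing)

-- A field (commutative ring with 0 ≠ 1 in which every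
-- nonzero element is invertible) whose carrier is in bijection with Fin q.
-- q is then the order of the field (necessarily a prime power).

record FiniteField : Set₁ where
  field
    Carrier  : Set
    _+_ _*_  : Carrier → Carrier → Carrier
    -_       : Carrier → Carrier
    0# 1#    : Carrier
    isCommutativeRing : IsCommutativeRing _≡_ _+_ _*_ -_ 0# 1#
    0≢1      : 0# ≢ 1#
    invertible : ∀ x → x ≢ 0# → Σ Carrier (λ y → x * y ≡ 1#)
    q        : ℕ
    toF      : Fin q → Carrier
    fromF    : Carrier → Fin q
    toF∘fromF : ∀ x → toF (fromF x) ≡ x
    fromF∘toF : ∀ i → fromF (toF i) ≡ i

-- all subsets of a list (each subset once, as an order-preserving sublist)
sublists : {A : Set} → List A → List (List A)
sublists []       = [ [] ]
sublists (x ∷ xs) = sublists xs ++ List.map (x ∷_) (sublists xs)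

tuples : {A : Set} → List A → (k : ℕ) → List (Vec A k)
tuples xs zero    = [ [] ]
tuples xs (suc k) = concatMap (λ x → List.map (x ∷_) (tuples xs k)) xs

-- rational a / b  (b = 0 never occurs in the uses below; convention 0)
frac : ℕ → ℕ → ℚ
frac a zero    = 0ℚ
frac a (suc b) = (+ a) ℚ./ suc b

divℕ : ℚ → ℕ → ℚ
divℕ x zero    = 0ℚ
divℕ x (suc b) = x ℚ.* ((+ 1) ℚ./ suc b)

sumℚ : List ℚ → ℚ
sumℚ = List.foldr ℚ._+_ 0ℚ

-- Linear algebra over a finite field, X = F_q^N (coordinate space)

module _ (F : FiniteField) where
  open FiniteField F renaming (_+_ to _+F_; _*_ to _*F_)

  q-1-nonZero : NonZero (q ∸ 1)
  q-1-nonZero = helper q toF fromF toF∘fromF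
    where
    helper : (m : ℕ) (t : Fin m → Carrier) (f : Carrier → Fin m) →
             (∀ x → t (f x) ≡ x) → NonZero (m ∸ 1)
    helper zero t f tf with f 0#
    ... | ()
    helper (suc zero) t f tf with f 0# | f 1# | tf 0# | tf 1#
    ... | Fin.zero | Fin.zero | e0 | e1 with 0≢1 (trans (sym e0) e1)
    ...   | ()
    helper (suc (suc m)) t f tf = _

  numPoints : ℕ → ℕ
  numPoints N = ((q ^ N) ∸ 1) / (q ∸ 1)
    where instance _ = q-1-nonZero

  numOutside : ℕ → ℕ → ℕ
  numOutside N k = ((q ^ N) ∸ (q ^ k)) / (q ∸ 1)
    where instance _ = q-1-nonZero

  elems : List Carrier
  elems = List.map toF (List.allFin q)

  eqF : Carrier → Carrier → Bool
  eqF x y = ⌊ fromF x Fin.≟ fromF y ⌋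

  Vector : ℕ → Set
  Vector N = Vec Carrier N

  eqV : {N : ℕ} → Vector N → Vector N → Bool
  eqV []       []       = true
  eqV (x ∷ xs) (y ∷ ys) = eqF x y ∧ eqV xs ys

  zeroV : (N : ℕ) → Vector N
  zeroV N = Vec.replicate N 0#

  addV : {N : ℕ} → Vector N → Vector N → Vector N
  addV = Vec.zipWith _+F_

  scaleV : {N : ℕ} → Carrier → Vector N → Vector N
  scaleV c = Vec.map (c *F_)

  allVecs : (N : ℕ) → List (Vector N)
  allVecs zero    = [ [] ]
  allVecs (suc N) = concatMap (λ x → List.map (x ∷_) (allVecs N)) elems

  memb : {N : ℕ} → Vector N → List (Vector N) → Bool
  memb v S = any (eqV v) S

  lincomb : {N k : ℕ} → Vec Carrier k → Vec (Vector N) k → Vector N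
  lincomb {N} []       []       = zeroV N
  lincomb     (c ∷ cs) (b ∷ bs) = addV (scaleV c b) (lincomb cs bs)

  isSubspace : {N : ℕ} → List (Vector N) → Bool
  isSubspace {N} S =
    memb (zeroV N) S
    ∧ all (λ u → all (λ v → memb (addV u v) S) S) S
    ∧ all (λ c → all (λ u → memb (scaleV c u) S) S) elems

  linIndep : {N k : ℕ} → Vec (Vector N) k → Bool
  linIndep {N} {k} b =
    all (λ c → not (eqV (lincomb c b) (zeroV N)) ∨ eqV c (zeroV k)) (allVecs k)

  spans : {N k : ℕ} → Vec (Vector N) k → List (Vector N) → Bool
  spans {N} {k} b S = all (λ s → any (λ c → eqV (lincomb c b) s) (allVecs k)) S

  hasDim : {N : ℕ} → ℕ → List (Vector N) → Bool
  hasDim k S = any (λ b → linIndep b ∧ spans b S) (tuples S k)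

  -- G_q(X, j) for X = F_q^N : j-dimensional subspaces, each given as the
  -- list of its vectors (a sublist of allVecs N)
  Gr : (N j : ℕ) → List (List (Vector N))
  Gr N j = filterᵇ (λ S → isSubspace S ∧ hasDim j S) (sublists (allVecs N))

  contained : {N : ℕ} → List (Vector N) → List (Vector N) → Bool
  contained p V = all (λ v → memb v V) p

  distinguishes : {N : ℕ} → List (Vector N) → List (List (Vector N)) → Bool
  distinguishes V P = all (λ p → not (contained p V)) P

  pointSets : (N ℓ : ℕ) → List (List (List (Vector N)))
  pointSets N ℓ = filterᵇ (λ P → length P ℕ.≡ᵇ ℓ) (sublists (Gr N 1))

  δ : (N k : ℕ) → List (List (Vector N)) → ℚ
  δ N k P = frac (length (filterᵇ (λ V → distinguishes V P) (Gr N k)))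
                 (length (Gr N k))

  δ̂ : (N k ℓ : ℕ) → ℚ
  δ̂ N k ℓ = divℕ (sumℚ (List.map (δ N k) (pointSets N ℓ)))
                 (numPoints N C ℓ)

-- Double counting the pairs (P, V) of an ℓ-set P of points and a k-space V that distinguishes it
-- turns the average of δ_q(X,k,P) over P into an average over V of the number of ℓ-sets of points
-- outside V. That number is C(o, ℓ) for every V, with o = (q^N − q^k)/(q − 1), because a
-- j-dimensional subspace contains (q^j − 1)/(q − 1) points: double count its nonzero vectors
-- against the points containing them, each nonzero vector spanning exactly one point and each
-- point containing q − 1 nonzero vectors.
module Submission where

open import Defs
open import Data.Bool using (true; not; _∧_)
open import Data.Bool.ListAction using (all)
open import Data.List using (List; length; filterᵇ)
open import Data.List.Membership.Propositional using (_∈_)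
import Data.List.Relation.Unary.All as ListAll
open import Data.List.Relation.Unary.All.Properties using (all⁻)
open import Data.Nat as ℕ using (ℕ; suc; _≤_; _∸_; _^_)
import Data.Nat.Properties as ℕ
open import Data.Nat.Combinatorics using (_C_)
open import Data.Nat.DivMod using (_/_; m*n/n≡m)
open import Data.Product using (proj₁)
open import Function using (const; mk⇔; _∘′_)
open import Relation.Binary.PropositionalEquality

module Counting where

  open import Data.Bool using (Bool; true; false; T; _∧_; not)
  open import Data.Bool.ListAction using (all)
  open import Data.Empty using (⊥-elim)
  open import Data.List using (List; []; _∷_; _++_; map; concatMap; length; filterᵇ; cartesianProductWith)
  open import Data.List.Membership.Propositional using (_∈_; _∉_)
  open import Data.List.Membership.Propositional.Properties using (∈-++⁺ˡ; ∈-++⁺ʳ; ∈-++⁻; ∈-map⁺; ∈-map⁻)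
  open import Data.List.Properties using (length-++; length-map)
  open import Data.List.Relation.Binary.Subset.Propositional using (_⊆_)
  import Data.List.Relation.Unary.All as All
  open import Data.List.Relation.Unary.All using (All; []; _∷_)
  open import Data.List.Relation.Unary.Any using (here; there)
  open import Data.List.Relation.Unary.Unique.Propositional using (Unique; []; _∷_)
  open import Data.Nat using (ℕ; zero; suc; _+_; _*_; _≡ᵇ_; NonZero)
  open import Data.Nat.Combinatorics using (_C_; nCk+nC[k+1]≡[n+1]C[k+1])
  open import Data.Nat.Properties using (+-assoc; +-suc; +-comm; +-identityʳ; *-zeroʳ; *-distribˡ-+; +-commutativeSemigroup)
  open import Algebra.Properties.CommutativeSemigroup +-commutativeSemigroup using (interchange)
  open import Data.Product using (_,_)
  open import Data.Sum using (inj₁; inj₂)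
  open import Function using (_∘_; _$_; const; _⇔_; Equivalence; mk⇔)
  open import Function.Properties.Equivalence using () renaming (trans to ⇔-trans; sym to ⇔-sym)
  open import Relation.Binary.PropositionalEquality
  open import Relation.Nullary using (¬_)

  private
    variable
      A B : Set

  indicator : Bool → ℕ
  indicator true  = 1
  indicator false = 0

  sumBy : (A → ℕ) → List A → ℕ
  sumBy f []       = 0
  sumBy f (x ∷ xs) = f x + sumBy f xs

  count : (A → Bool) → List A → ℕ
  count p = sumBy (indicator ∘ p)

  module _ {f g : A → ℕ} where

    sumBy-cong : ∀ xs → (∀ {x} → x ∈ xs → f x ≡ g x) → sumBy f xs ≡ sumBy g xs
    sumBy-cong []       _  = refl
    sumBy-cong (x ∷ xs) eq = cong₂ _+_ (eq (here refl)) (sumBy-cong xs (eq ∘ there))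

    sumBy-+ : ∀ xs → sumBy (λ x → f x + g x) xs ≡ sumBy f xs + sumBy g xs
    sumBy-+ []       = refl
    sumBy-+ (x ∷ xs) = trans (cong (f x + g x +_) (sumBy-+ xs)) (interchange (f x) (g x) _ _)

  sumBy-*ˡ : ∀ c (f : A → ℕ) xs → sumBy (λ x → c * f x) xs ≡ c * sumBy f xs
  sumBy-*ˡ c f []       = sym (*-zeroʳ c)
  sumBy-*ˡ c f (x ∷ xs) = trans (cong (c * f x +_) (sumBy-*ˡ c f xs)) (sym (*-distribˡ-+ c (f x) _))

  sumBy-const : ∀ c (xs : List A) → sumBy (const c) xs ≡ length xs * c
  sumBy-const c []       = refl
  sumBy-const c (x ∷ xs) = cong (c +_) (sumBy-const c xs)

  sumBy-++ : ∀ (f : A → ℕ) xs ys → sumBy f (xs ++ ys) ≡ sumBy f xs + sumBy f ys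
  sumBy-++ f []       ys = refl
  sumBy-++ f (x ∷ xs) ys = trans (cong (f x +_) (sumBy-++ f xs ys)) (sym (+-assoc (f x) _ _))

  sumBy-map : ∀ (f : B → ℕ) (g : A → B) xs → sumBy f (map g xs) ≡ sumBy (f ∘ g) xs
  sumBy-map f g []       = refl
  sumBy-map f g (x ∷ xs) = cong (f (g x) +_) (sumBy-map f g xs)

  sumBy-swap : ∀ (R : A → B → ℕ) xs ys →
               sumBy (λ x → sumBy (R x) ys) xs ≡ sumBy (λ y → sumBy (λ x → R x y) xs) ys
  sumBy-swap R []       ys = sym (sumBy-zero ys)
    where
    sumBy-zero : ∀ (ys : List B) → sumBy (const 0) ys ≡ 0
    sumBy-zero []       = refl
    sumBy-zero (_ ∷ ys) = sumBy-zero ys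
  sumBy-swap R (x ∷ xs) ys =
    trans (cong (sumBy (R x) ys +_) (sumBy-swap R xs ys)) (sym (sumBy-+ ys))

  count-cong : ∀ {p p′ : A → Bool} xs → (∀ {x} → x ∈ xs → T (p x) ⇔ T (p′ x)) → count p xs ≡ count p′ xs
  count-cong xs eq = sumBy-cong xs (cong indicator ∘ T-ext ∘ eq)
    where
    T-ext : ∀ {a b} → T a ⇔ T b → a ≡ b
    T-ext {false} {false} _  = refl
    T-ext {false} {true}  a⇔b = ⊥-elim (Equivalence.from a⇔b _)
    T-ext {true}  {false} a⇔b = ⊥-elim (Equivalence.to a⇔b _)
    T-ext {true}  {true}  _  = refl

  count-none : ∀ (p : A → Bool) xs → (∀ {x} → x ∈ xs → ¬ T (p x)) → count p xs ≡ 0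
  count-none p []       _   = refl
  count-none p (x ∷ xs) ¬px with p x | ¬px (here refl)
  ... | false | _   = count-none p xs (¬px ∘ there)
  ... | true  | ¬tt = ⊥-elim (¬tt _)

  count-true : ∀ (xs : List A) → count (const true) xs ≡ length xs
  count-true []       = refl
  count-true (_ ∷ xs) = cong suc (count-true xs)

  count-split : ∀ (p q : A → Bool) xs → count p xs ≡ count (λ x → p x ∧ q x) xs + count (λ x → p x ∧ not (q x)) xs
  count-split p q []       = refl
  count-split p q (x ∷ xs) with p x | q x
  ... | false | _     = count-split p q xs
  ... | true  | true  = cong suc (count-split p q xs)
  ... | true  | false = trans (cong suc (count-split p q xs)) (sym (+-suc _ _))

  length-filterᵇ : ∀ (p : A → Bool) xs → length (filterᵇ p xs) ≡ count p xs
  length-filterᵇ p []       = refl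
  length-filterᵇ p (x ∷ xs) with p x
  ... | true  = cong suc (length-filterᵇ p xs)
  ... | false = length-filterᵇ p xs

  count-filterᵇ : ∀ (p q : A → Bool) xs → count p (filterᵇ q xs) ≡ count (λ x → q x ∧ p x) xs
  count-filterᵇ p q []       = refl
  count-filterᵇ p q (x ∷ xs) with q x
  ... | true  = cong (indicator (p x) +_) (count-filterᵇ p q xs)
  ... | false = count-filterᵇ p q xs

  count-unique : ∀ {p : A → Bool} {x xs} → Unique xs → x ∈ xs →
                 (∀ {y} → y ∈ xs → T (p y) ⇔ y ≡ x) → count p xs ≡ 1
  count-unique {p = p} {x} (z∉zs ∷ _) (here refl) p⇔≡x with p x | Equivalence.from (p⇔≡x (here refl)) refl
  ... | true | _ = cong suc $ count-none p _ (λ y∈zs py → All.lookup z∉zs y∈zs (sym (Equivalence.to (p⇔≡x (there y∈zs)) py)))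
  count-unique {p = p} {xs = z ∷ _} (z∉zs ∷ zs!) (there x∈zs) p⇔≡x with p z in pz≡
  ... | true  = ⊥-elim (All.lookup z∉zs x∈zs (Equivalence.to (p⇔≡x (here refl)) (subst T (sym pz≡) _)))
  ... | false = count-unique zs! x∈zs (p⇔≡x ∘ there)

  count-sublists-all : ∀ (p : A → Bool) xs ℓ →
                       count (λ ys → (length ys ≡ᵇ ℓ) ∧ all p ys) (sublists xs) ≡ count p xs C ℓ
  count-sublists-all p []       zero    = refl
  count-sublists-all p []       (suc ℓ) = refl
  count-sublists-all p (x ∷ xs) ℓ =
    trans (sumBy-++ _ (sublists xs) _)
          (trans (cong (count (sized ℓ) (sublists xs) +_) (sumBy-map _ (x ∷_) (sublists xs)))
                 (without-x+with-x ℓ))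
    where
    sized : ℕ → List _ → Bool
    sized ℓ ys = (length ys ≡ᵇ ℓ) ∧ all p ys
    without-x+with-x : ∀ ℓ → count (sized ℓ) (sublists xs) + count (sized ℓ ∘ (x ∷_)) (sublists xs)
                             ≡ count p (x ∷ xs) C ℓ
    without-x+with-x zero = cong₂ _+_ (count-sublists-all p xs 0) (count-none (sized 0 ∘ (x ∷_)) (sublists xs) (λ _ ()))
    without-x+with-x (suc ℓ) with p x
    ... | true  = trans (cong₂ _+_ (count-sublists-all p xs (suc ℓ)) (count-sublists-all p xs ℓ))
                        (trans (+-comm (count p xs C suc ℓ) _) (nCk+nC[k+1]≡[n+1]C[k+1] (count p xs) ℓ))
    ... | false = trans (cong₂ _+_ (count-sublists-all p xs (suc ℓ))
                                   (count-none (λ ys → (length ys ≡ᵇ ℓ) ∧ false) (sublists xs) (λ {ys} _ → ∧-false (length ys ≡ᵇ ℓ))))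
                        (+-identityʳ _)
      where
      ∧-false : ∀ b → ¬ T (b ∧ false)
      ∧-false true  ()
      ∧-false false ()

  sublists-⊆ : ∀ {xs ys : List A} → ys ∈ sublists xs → ys ⊆ xs
  sublists-⊆ {xs = []}     (here refl) ()
  sublists-⊆ {xs = x ∷ xs} ys∈ y∈ys with ∈-++⁻ (sublists xs) ys∈
  ... | inj₁ ys∈′ = there (sublists-⊆ ys∈′ y∈ys)
  ... | inj₂ x∷ys∈ with ∈-map⁻ (x ∷_) x∷ys∈
  ...   | zs , zs∈ , refl with y∈ys
  ...     | here y≡x   = here y≡x
  ...     | there y∈zs = there (sublists-⊆ zs∈ y∈zs)

  filterᵇ∈sublists : ∀ (p : A → Bool) xs → filterᵇ p xs ∈ sublists xs
  filterᵇ∈sublists p []       = here refl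
  filterᵇ∈sublists p (x ∷ xs) with p x
  ... | true  = ∈-++⁺ʳ (sublists xs) (∈-map⁺ (x ∷_) (filterᵇ∈sublists p xs))
  ... | false = ∈-++⁺ˡ (filterᵇ∈sublists p xs)

  SelectedBy : (A → Bool) → List A → List A → Set
  SelectedBy χ xs ys = ∀ {u} → u ∈ xs → (u ∈ ys ⇔ T (χ u))

  count-sublists-selectedBy : ∀ {xs} (χ : A → Bool) (f : List A → Bool) → Unique xs →
    (∀ {ys} → ys ∈ sublists xs → T (f ys) ⇔ SelectedBy χ xs ys) → count f (sublists xs) ≡ 1
  count-sublists-selectedBy {xs = []} χ f [] f⇔ with f [] | Equivalence.from (f⇔ (here refl)) (λ ())
  ... | true | _ = refl
  count-sublists-selectedBy {xs = x ∷ xs} χ f (x∉xs ∷ xs!) f⇔ =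
    trans (sumBy-++ _ (sublists xs) _)
          (trans (cong (count f (sublists xs) +_) (sumBy-map _ (x ∷_) (sublists xs)))
                 (by-χx (χ x) refl))
    where
    x∉sub : ∀ {ys} → ys ∈ sublists xs → x ∉ ys
    x∉sub ys∈ x∈ys = All.lookup x∉xs (sublists-⊆ ys∈ x∈ys) refl
    inˡ : ∀ {ys} → ys ∈ sublists xs → ys ∈ sublists (x ∷ xs)
    inˡ = ∈-++⁺ˡ
    inʳ : ∀ {ys} → ys ∈ sublists xs → (x ∷ ys) ∈ sublists (x ∷ xs)
    inʳ = ∈-++⁺ʳ (sublists xs) ∘ ∈-map⁺ (x ∷_)
    ∈-∷-≢ : ∀ {u ys} → u ∈ xs → u ∈ x ∷ ys ⇔ u ∈ ys
    ∈-∷-≢ u∈xs = mk⇔ (λ { (here refl) → ⊥-elim (All.lookup x∉xs u∈xs refl) ; (there u∈ys) → u∈ys }) there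
    by-χx : ∀ b → χ x ≡ b → count f (sublists xs) + count (f ∘ (x ∷_)) (sublists xs) ≡ 1
    by-χx true χx = cong₂ _+_
      (count-none f (sublists xs) λ ys∈ fys →
         x∉sub ys∈ (Equivalence.from (Equivalence.to (f⇔ (inˡ ys∈)) fys (here refl)) (subst T (sym χx) _)))
      (count-sublists-selectedBy χ (f ∘ (x ∷_)) xs! λ {ys} ys∈ → mk⇔
        (λ fxys {u} u∈xs → ⇔-trans (⇔-sym (∈-∷-≢ u∈xs)) (Equivalence.to (f⇔ (inʳ ys∈)) fxys (there u∈xs)))
        (λ sel → Equivalence.from (f⇔ (inʳ ys∈)) λ
           { {_} (here refl) → mk⇔ (λ _ → subst T (sym χx) _) (λ _ → here refl)
           ; {_} (there u∈xs) → ⇔-trans (∈-∷-≢ u∈xs) (sel u∈xs) }))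
    by-χx false χx = trans (cong₂ _+_
      (count-sublists-selectedBy χ f xs! λ {ys} ys∈ → mk⇔
        (λ fys {u} u∈xs → Equivalence.to (f⇔ (inˡ ys∈)) fys (there u∈xs))
        (λ sel → Equivalence.from (f⇔ (inˡ ys∈)) λ
           { {_} (here refl) → mk⇔ (⊥-elim ∘ x∉sub ys∈) (λ χx′ → ⊥-elim (subst T χx χx′))
           ; {_} (there u∈xs) → sel u∈xs }))
      (count-none (f ∘ (x ∷_)) (sublists xs) λ ys∈ fxys →
         subst T χx (Equivalence.to (Equivalence.to (f⇔ (inʳ ys∈)) fxys (here refl)) (here refl))))
      (+-identityʳ 1)

  concatMap-map≡cartesianProductWith : ∀ {C : Set} (f : A → B → C) xs ys →
    concatMap (λ x → map (f x) ys) xs ≡ cartesianProductWith f xs ys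
  concatMap-map≡cartesianProductWith f []       ys = refl
  concatMap-map≡cartesianProductWith f (x ∷ xs) ys = cong (map (f x) ys ++_) (concatMap-map≡cartesianProductWith f xs ys)

  length-cartesianProductWith : ∀ {C : Set} (f : A → B → C) xs ys →
    length (cartesianProductWith f xs ys) ≡ length xs * length ys
  length-cartesianProductWith f []       ys = refl
  length-cartesianProductWith f (x ∷ xs) ys = begin
    length (map (f x) ys ++ cartesianProductWith f xs ys)   ≡⟨ length-++ (map (f x) ys) ⟩
    length (map (f x) ys) + length (cartesianProductWith f xs ys)
      ≡⟨ cong₂ _+_ (length-map (f x) ys) (length-cartesianProductWith f xs ys) ⟩
    length ys + length xs * length ys                       ∎
    where open ≡-Reasoning

  ∈⇒nonZero-length : ∀ {x : A} {xs} → x ∈ xs → NonZero (length xs)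
  ∈⇒nonZero-length {xs = _ ∷ _} _ = _

module Mean where

  open import Data.Integer as ℤ using (ℤ; +_)
  import Data.Integer.Properties as ℤ
  open import Data.Integer.Tactic.RingSolver using (solve-∀)
  open import Data.List using ([]; _∷_; map)
  open import Data.Nat as ℕ using (ℕ; zero; suc; NonZero)
  open import Data.Rational as ℚ using (ℚ; 0ℚ)
  import Data.Rational.Properties as ℚ
  open import Data.Rational.Unnormalised as ℚᵘ using (mkℚᵘ; *≡*)
  import Data.Rational.Unnormalised.Properties as ℚᵘ
  open import Relation.Binary.PropositionalEquality

  open Counting using (sumBy)

  private
    variable
      A : Set

  frac-+ : ∀ a b n → frac a n ℚ.+ frac b n ≡ frac (a ℕ.+ b) n
  frac-+ a b zero    = ℚ.+-identityˡ 0ℚ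
  frac-+ a b (suc g) = ℚ.toℚᵘ-injective (begin
      ℚ.toℚᵘ (frac a (suc g) ℚ.+ frac b (suc g))            ≈⟨ ℚ.toℚᵘ-homo-+ (frac a (suc g)) (frac b (suc g)) ⟩
      ℚ.toℚᵘ (frac a (suc g)) ℚᵘ.+ ℚ.toℚᵘ (frac b (suc g))  ≈⟨ ℚᵘ.+-cong (ℚ.toℚᵘ-fromℚᵘ (mkℚᵘ (+ a) g)) (ℚ.toℚᵘ-fromℚᵘ (mkℚᵘ (+ b) g)) ⟩
      mkℚᵘ (+ a) g ℚᵘ.+ mkℚᵘ (+ b) g                       ≈⟨ *≡* common-denominator ⟩
      mkℚᵘ (+ (a ℕ.+ b)) g                                 ≈⟨ ℚᵘ.≃-sym (ℚ.toℚᵘ-fromℚᵘ (mkℚᵘ (+ (a ℕ.+ b)) g)) ⟩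
      ℚ.toℚᵘ (frac (a ℕ.+ b) (suc g))                      ∎)
    where
    open ℚᵘ.≃-Reasoning
    ring : ∀ (a b s : ℤ) → (a ℤ.* s ℤ.+ b ℤ.* s) ℤ.* s ≡ (a ℤ.+ b) ℤ.* (s ℤ.* s)
    ring = solve-∀
    common-denominator : (+ a ℤ.* + suc g ℤ.+ + b ℤ.* + suc g) ℤ.* + suc g ≡ + (a ℕ.+ b) ℤ.* + (suc g ℕ.* suc g)
    common-denominator = trans (ring (+ a) (+ b) (+ suc g))
                               (sym (cong₂ ℤ._*_ (ℤ.pos-+ a b) (ℤ.pos-* (suc g) (suc g))))

  sumℚ-frac : ∀ (f : A → ℕ) n xs → sumℚ (map (λ x → frac (f x) n) xs) ≡ frac (sumBy f xs) n
  sumℚ-frac f zero    []       = refl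
  sumℚ-frac f (suc g) []       = sym (ℚ.0/n≡0 (suc g))
  sumℚ-frac f n       (x ∷ xs) = trans (cong (frac (f x) n ℚ.+_) (sumℚ-frac f n xs)) (frac-+ (f x) (sumBy f xs) n)

  divℕ-frac-*ʳ : ∀ a n m .{{_ : NonZero n}} → divℕ (frac (a ℕ.* n) n) m ≡ frac a m
  divℕ-frac-*ʳ a n       zero    = refl
  divℕ-frac-*ʳ a (suc g) (suc m) = ℚ.toℚᵘ-injective (begin
      ℚ.toℚᵘ (frac (a ℕ.* suc g) (suc g) ℚ.* (+ 1 ℚ./ suc m))
        ≈⟨ ℚ.toℚᵘ-homo-* (frac (a ℕ.* suc g) (suc g)) (+ 1 ℚ./ suc m) ⟩
      ℚ.toℚᵘ (frac (a ℕ.* suc g) (suc g)) ℚᵘ.* ℚ.toℚᵘ (+ 1 ℚ./ suc m)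
        ≈⟨ ℚᵘ.*-cong (ℚ.toℚᵘ-fromℚᵘ (mkℚᵘ (+ (a ℕ.* suc g)) g)) (ℚ.toℚᵘ-fromℚᵘ (mkℚᵘ (+ 1) m)) ⟩
      mkℚᵘ (+ (a ℕ.* suc g)) g ℚᵘ.* mkℚᵘ (+ 1) m
        ≈⟨ *≡* cancel ⟩
      mkℚᵘ (+ a) m
        ≈⟨ ℚᵘ.≃-sym (ℚ.toℚᵘ-fromℚᵘ (mkℚᵘ (+ a) m)) ⟩
      ℚ.toℚᵘ (frac a (suc m)) ∎)
    where
    open ℚᵘ.≃-Reasoning
    ring : ∀ (x s t : ℤ) → (x ℤ.* s ℤ.* + 1) ℤ.* t ≡ x ℤ.* (s ℤ.* t)
    ring = solve-∀
    cancel : (+ (a ℕ.* suc g) ℤ.* + 1) ℤ.* + suc m ≡ + a ℤ.* + (suc g ℕ.* suc m)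
    cancel = trans (cong (λ z → (z ℤ.* + 1) ℤ.* + suc m) (ℤ.pos-* a (suc g)))
                   (trans (ring (+ a) (+ suc g) (+ suc m)) (cong (+ a ℤ.*_) (sym (ℤ.pos-* (suc g) (suc m)))))

  mean-frac : ∀ (f : A → ℕ) a n m ys .{{_ : NonZero n}} → sumBy f ys ≡ a ℕ.* n →
              divℕ (sumℚ (map (λ y → frac (f y) n) ys)) m ≡ frac a m
  mean-frac f a n m ys sum≡ =
    trans (cong (λ s → divℕ s m) (trans (sumℚ-frac f n ys) (cong (λ s → frac s n) sum≡)))
          (divℕ-frac-*ʳ a n m)

module LinearAlgebra (F : FiniteField) where

  open import Algebra.Bundles using (CommutativeRing)
  open import Algebra.Structures using (IsCommutativeRing)
  open import Data.Bool using (Bool; true; false; T; T?; _∧_; _∨_; not)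
  open import Data.Bool.ListAction using (any; all)
  open import Data.Bool.Properties using (T-∧; T-not-≡)
  open import Data.Empty using (⊥-elim)
  open import Data.List as List using (List; []; _∷_; length; allFin; cartesianProductWith)
  open import Data.List.Membership.Propositional using (_∈_; find; lose)
  open import Data.List.Membership.Propositional.Properties
    using (∈-filter⁻; ∈-filter⁺; ∈-map⁺; ∈-allFin; ∈-cartesianProductWith⁺; ∈-cartesianProductWith⁻)
  open import Data.List.Properties using (length-map; length-tabulate)
  open import Data.List.Relation.Unary.All as ListAll using ()
  open import Data.List.Relation.Unary.All.Properties using (all⁺; all⁻)
  import Data.List.Relation.Unary.Any as Any
  open import Data.List.Relation.Unary.Any using (here)
  open import Data.List.Relation.Unary.Any.Properties using (any⁺; any⁻)
  open import Data.List.Relation.Unary.Unique.Propositional using (Unique; []; _∷_)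
  open import Data.List.Relation.Unary.Unique.Propositional.Properties using (map⁺; allFin⁺; cartesianProductWith⁺)
  open import Data.Nat as ℕ using (ℕ; zero; suc; _^_)
  import Data.Nat.Properties as ℕ
  open import Data.Product using (_×_; _,_; ∃-syntax; proj₁; proj₂)
  open import Data.Vec as Vec using (Vec; []; _∷_)
  open import Data.Vec.Properties
    using ( ∷-injective; zipWith-assoc; zipWith-identityˡ; zipWith-identityʳ; zipWith-inverseˡ; zipWith-inverseʳ
          ; map-replicate; map-cong; map-const; map-id; map-∘)
  open import Data.Vec.Relation.Unary.All as VecAll using ([]; _∷_)
  open import Function using (_∘_; _⇔_; Equivalence; mk⇔)
  open import Function.Properties.Equivalence using () renaming (trans to ⇔-trans)
  open import Relation.Binary.Definitions using (DecidableEquality)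
  open import Relation.Binary.PropositionalEquality
  open import Relation.Nullary.Decidable using (toWitness; fromWitness; map′; yes; no)

  open Counting

  open FiniteField F
  open IsCommutativeRing isCommutativeRing
    using ( +-assoc; +-identityˡ; +-identityʳ; -‿inverseˡ; -‿inverseʳ
          ; *-assoc; *-comm; *-identityˡ; *-identityʳ; distribˡ; distribʳ; zeroˡ; zeroʳ)

  ring : CommutativeRing _ _
  ring = record { isCommutativeRing = isCommutativeRing }

  open import Algebra.Properties.CommutativeSemigroup (CommutativeRing.+-commutativeSemigroup ring) using (interchange)

  eqF⇒≡ : ∀ {x y} → T (eqF F x y) → x ≡ y
  eqF⇒≡ {x} {y} x==y = trans (sym (toF∘fromF x)) (trans (cong toF (toWitness x==y)) (toF∘fromF y))

  eqF-refl : ∀ x → T (eqF F x x)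
  eqF-refl x = fromWitness refl

  eqV⇒≡ : ∀ {n} {u v : Vector F n} → T (eqV F u v) → u ≡ v
  eqV⇒≡ {u = []}    {[]}    _    = refl
  eqV⇒≡ {u = x ∷ u} {y ∷ v} u==v with Equivalence.to T-∧ u==v
  ... | x==y , u′==v′ = cong₂ _∷_ (eqF⇒≡ x==y) (eqV⇒≡ u′==v′)

  ≡⇒eqV : ∀ {n} {u v : Vector F n} → u ≡ v → T (eqV F u v)
  ≡⇒eqV {u = []}    refl = _
  ≡⇒eqV {u = x ∷ u} refl = Equivalence.from T-∧ (eqF-refl x , ≡⇒eqV {u = u} refl)

  memb⇒∈ : ∀ {n} {v : Vector F n} {S} → T (memb F v S) → v ∈ S
  memb⇒∈ {S = S} = Any.map eqV⇒≡ ∘ any⁻ _ S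

  ∈⇒memb : ∀ {n} {v : Vector F n} {S} → v ∈ S → T (memb F v S)
  ∈⇒memb = any⁺ _ ∘ Any.map ≡⇒eqV

  ∈-elems : ∀ x → x ∈ elems F
  ∈-elems x = subst (_∈ elems F) (toF∘fromF x) (∈-map⁺ toF (∈-allFin (fromF x)))

  elems-unique : Unique (elems F)
  elems-unique = map⁺ toF-injective (allFin⁺ q)
    where
    toF-injective : ∀ {i j} → toF i ≡ toF j → i ≡ j
    toF-injective {i} {j} eq = trans (sym (fromF∘toF i)) (trans (cong fromF eq) (fromF∘toF j))

  length-elems : length (elems F) ≡ q
  length-elems = trans (length-map toF (allFin q)) (length-tabulate (λ i → i))

  allVecs-suc : ∀ n → allVecs F (suc n) ≡ cartesianProductWith _∷_ (elems F) (allVecs F n)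
  allVecs-suc n = concatMap-map≡cartesianProductWith _∷_ (elems F) (allVecs F n)

  ∈-allVecs : ∀ {n} (v : Vector F n) → v ∈ allVecs F n
  ∈-allVecs []      = here refl
  ∈-allVecs (x ∷ v) = subst (x ∷ v ∈_) (sym (allVecs-suc _)) (∈-cartesianProductWith⁺ _∷_ (∈-elems x) (∈-allVecs v))

  allVecs-unique : ∀ n → Unique (allVecs F n)
  allVecs-unique zero    = ListAll.[] ∷ []
  allVecs-unique (suc n) = subst Unique (sym (allVecs-suc n))
    (cartesianProductWith⁺ _∷_ ∷-injective elems-unique (allVecs-unique n))

  length-allVecs : ∀ n → length (allVecs F n) ≡ q ^ n
  length-allVecs zero    = refl
  length-allVecs (suc n) = begin
    length (allVecs F (suc n))                                   ≡⟨ cong length (allVecs-suc n) ⟩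
    length (cartesianProductWith _∷_ (elems F) (allVecs F n))   ≡⟨ length-cartesianProductWith _∷_ (elems F) (allVecs F n) ⟩
    length (elems F) ℕ.* length (allVecs F n)                    ≡⟨ cong₂ ℕ._*_ length-elems (length-allVecs n) ⟩
    q ℕ.* q ^ n                                                  ∎
    where open ≡-Reasoning

  tuples-suc : ∀ {n} (S : List (Vector F n)) k → tuples S (suc k) ≡ cartesianProductWith _∷_ S (tuples S k)
  tuples-suc S k = concatMap-map≡cartesianProductWith _∷_ S (tuples S k)

  ∈-tuples⁺ : ∀ {n k} {S : List (Vector F n)} {t : Vec (Vector F n) k} → VecAll.All (_∈ S) t → t ∈ tuples S k
  ∈-tuples⁺ []                    = here refl
  ∈-tuples⁺ {S = S} (x∈S ∷ t∈S) = subst (_ ∈_) (sym (tuples-suc S _)) (∈-cartesianProductWith⁺ _∷_ x∈S (∈-tuples⁺ t∈S))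

  ∈-tuples⁻ : ∀ {n k} {S : List (Vector F n)} {t : Vec (Vector F n) k} → t ∈ tuples S k → VecAll.All (_∈ S) t
  ∈-tuples⁻ {k = zero} {t = []} _ = []
  ∈-tuples⁻ {k = suc k} {S} t∈ with ∈-cartesianProductWith⁻ _∷_ S (tuples S k) (subst (_ ∈_) (tuples-suc S k) t∈)
  ... | x , t′ , x∈S , t′∈ , refl = x∈S ∷ ∈-tuples⁻ t′∈

  negV : ∀ {n} → Vector F n → Vector F n
  negV = Vec.map -_

  addV-identityˡ : ∀ {n} (v : Vector F n) → addV F (zeroV F n) v ≡ v
  addV-identityˡ = zipWith-identityˡ +-identityˡ

  addV-identityʳ : ∀ {n} (v : Vector F n) → addV F v (zeroV F n) ≡ v
  addV-identityʳ = zipWith-identityʳ +-identityʳ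

  addV-assoc : ∀ {n} (u v w : Vector F n) → addV F (addV F u v) w ≡ addV F u (addV F v w)
  addV-assoc = zipWith-assoc +-assoc

  addV-inverseˡ : ∀ {n} (v : Vector F n) → addV F (negV v) v ≡ zeroV F n
  addV-inverseˡ = zipWith-inverseˡ -‿inverseˡ

  addV-interchange : ∀ {n} (a b c d : Vector F n) →
                     addV F (addV F a b) (addV F c d) ≡ addV F (addV F a c) (addV F b d)
  addV-interchange []       []       []       []       = refl
  addV-interchange (a ∷ as) (b ∷ bs) (c ∷ cs) (d ∷ ds) = cong₂ _∷_ (interchange a b c d) (addV-interchange as bs cs ds)

  addV-identityˡ-unique : ∀ {n} (x w : Vector F n) → addV F x w ≡ w → x ≡ zeroV F n
  addV-identityˡ-unique {n} x w x+w≡w = begin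
    x                                  ≡⟨ sym (addV-identityʳ x) ⟩
    addV F x (zeroV F n)               ≡⟨ cong (addV F x) (sym (addV-inverseʳ w)) ⟩
    addV F x (addV F w (negV w))       ≡⟨ sym (addV-assoc x w (negV w)) ⟩
    addV F (addV F x w) (negV w)       ≡⟨ cong (λ z → addV F z (negV w)) x+w≡w ⟩
    addV F w (negV w)                  ≡⟨ addV-inverseʳ w ⟩
    zeroV F n                          ∎
    where
    open ≡-Reasoning
    addV-inverseʳ : ∀ {n} (v : Vector F n) → addV F v (negV v) ≡ zeroV F n
    addV-inverseʳ = zipWith-inverseʳ -‿inverseʳ

  scaleV-zeroʳ : ∀ {n} c → scaleV F c (zeroV F n) ≡ zeroV F n
  scaleV-zeroʳ {n} c = trans (map-replicate (c *_) 0# n) (cong (Vec.replicate n) (zeroʳ c))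

  scaleV-zeroˡ : ∀ {n} (v : Vector F n) → scaleV F 0# v ≡ zeroV F n
  scaleV-zeroˡ v = trans (map-cong zeroˡ v) (map-const v 0#)

  scaleV-identityˡ : ∀ {n} (v : Vector F n) → scaleV F 1# v ≡ v
  scaleV-identityˡ v = trans (map-cong *-identityˡ v) (map-id v)

  scaleV-assoc : ∀ {n} a b (v : Vector F n) → scaleV F (a * b) v ≡ scaleV F a (scaleV F b v)
  scaleV-assoc a b v = trans (map-cong (*-assoc a b) v) (map-∘ (a *_) (b *_) v)

  scaleV-distribˡ : ∀ {n} c (u v : Vector F n) → scaleV F c (addV F u v) ≡ addV F (scaleV F c u) (scaleV F c v)
  scaleV-distribˡ c []      []      = refl
  scaleV-distribˡ c (x ∷ u) (y ∷ v) = cong₂ _∷_ (distribˡ c x y) (scaleV-distribˡ c u v)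

  scaleV-distribʳ : ∀ {n} a b (v : Vector F n) → scaleV F (a + b) v ≡ addV F (scaleV F a v) (scaleV F b v)
  scaleV-distribʳ a b []      = refl
  scaleV-distribʳ a b (x ∷ v) = cong₂ _∷_ (distribʳ x a b) (scaleV-distribʳ a b v)

  *-cancelˡ-zero : ∀ {c x} → c ≢ 0# → c * x ≡ 0# → x ≡ 0#
  *-cancelˡ-zero {c} {x} c≢0 cx≡0 with invertible c c≢0
  ... | c⁻¹ , cc⁻¹≡1 = begin
    x               ≡⟨ sym (*-identityˡ x) ⟩
    1# * x          ≡⟨ cong (_* x) (sym (trans (*-comm c⁻¹ c) cc⁻¹≡1)) ⟩
    (c⁻¹ * c) * x   ≡⟨ *-assoc c⁻¹ c x ⟩
    c⁻¹ * (c * x)   ≡⟨ cong (c⁻¹ *_) cx≡0 ⟩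
    c⁻¹ * 0#        ≡⟨ zeroʳ c⁻¹ ⟩
    0#              ∎
    where open ≡-Reasoning

  scaleV-cancelˡ-zero : ∀ {n c} {v : Vector F n} → c ≢ 0# → scaleV F c v ≡ zeroV F n → v ≡ zeroV F n
  scaleV-cancelˡ-zero {v = []}    c≢0 _    = refl
  scaleV-cancelˡ-zero {v = x ∷ v} c≢0 cv≡0 =
    cong₂ _∷_ (*-cancelˡ-zero c≢0 (cong Vec.head cv≡0)) (scaleV-cancelˡ-zero c≢0 (cong Vec.tail cv≡0))

  lincomb-zeroˡ : ∀ {N k} (b : Vec (Vector F N) k) → lincomb F (zeroV F k) b ≡ zeroV F N
  lincomb-zeroˡ         []      = refl
  lincomb-zeroˡ {N} (v ∷ b) = trans (cong₂ (addV F) (scaleV-zeroˡ v) (lincomb-zeroˡ b)) (addV-identityˡ (zeroV F N))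

  lincomb-addV : ∀ {N k} (c d : Vec Carrier k) (b : Vec (Vector F N) k) →
                 lincomb F (addV F c d) b ≡ addV F (lincomb F c b) (lincomb F d b)
  lincomb-addV []       []       []      = sym (addV-identityˡ _)
  lincomb-addV (c ∷ cs) (d ∷ ds) (v ∷ b) =
    trans (cong₂ (addV F) (scaleV-distribʳ c d v) (lincomb-addV cs ds b)) (addV-interchange _ _ _ _)

  lincomb-scaleV : ∀ {N k} a (c : Vec Carrier k) (b : Vec (Vector F N) k) →
                   lincomb F (scaleV F a c) b ≡ scaleV F a (lincomb F c b)
  lincomb-scaleV a []       []      = sym (scaleV-zeroʳ a)
  lincomb-scaleV a (c ∷ cs) (v ∷ b) =
    trans (cong₂ (addV F) (scaleV-assoc a c v) (lincomb-scaleV a cs b)) (sym (scaleV-distribˡ a _ _))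

  Independent : ∀ {N k} → Vec (Vector F N) k → Set
  Independent {N} {k} b = ∀ c → lincomb F c b ≡ zeroV F N → c ≡ zeroV F k

  lincomb-injective : ∀ {N k} {b : Vec (Vector F N) k} → Independent b →
                      ∀ {c d} → lincomb F c b ≡ lincomb F d b → c ≡ d
  lincomb-injective {k = k} {b} independent {c} {d} cb≡db = begin
    c                                ≡⟨ sym c-d+d≡c ⟩
    addV F (addV F c (negV d)) d     ≡⟨ cong (λ z → addV F z d) (independent _ [c-d]b≡0) ⟩
    addV F (zeroV F k) d             ≡⟨ addV-identityˡ d ⟩
    d                                ∎
    where
    open ≡-Reasoning
    c-d+d≡c : addV F (addV F c (negV d)) d ≡ c
    c-d+d≡c = trans (addV-assoc c (negV d) d) (trans (cong (addV F c) (addV-inverseˡ d)) (addV-identityʳ c))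
    [c-d]b≡0 : lincomb F (addV F c (negV d)) b ≡ _
    [c-d]b≡0 = addV-identityˡ-unique _ (lincomb F d b)
      (trans (sym (lincomb-addV (addV F c (negV d)) d b)) (trans (cong (λ z → lincomb F z b) c-d+d≡c) cb≡db))

  _∈Span_ : ∀ {N k} → Vector F N → Vec (Vector F N) k → Set
  u ∈Span b = ∃[ c ] lincomb F c b ≡ u

  linIndep⇒Independent : ∀ {N k} {b : Vec (Vector F N) k} → T (linIndep F b) → Independent b
  linIndep⇒Independent {b = b} indep c cb≡0 =
    eqV⇒≡ (implication (ListAll.lookup (all⁺ _ _ indep) (∈-allVecs c)) (≡⇒eqV cb≡0))
    where
    implication : ∀ {x y} → T (not x ∨ y) → T x → T y
    implication {true} y _ = y

  Independent⇒linIndep : ∀ {N k} {b : Vec (Vector F N) k} → Independent b → T (linIndep F b)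
  Independent⇒linIndep {N} {k} {b} independent =
    all⁻ _ (ListAll.tabulate {xs = allVecs F k} λ {c} _ → implication (≡⇒eqV ∘ independent c ∘ eqV⇒≡))
    where
    implication : ∀ {x y} → (T x → T y) → T (not x ∨ y)
    implication {false} _   = _
    implication {true}  x⇒y = x⇒y _

  record IsSubspace {N} (S : List (Vector F N)) : Set where
    field
      zero∈   : zeroV F N ∈ S
      addV∈   : ∀ {u v} → u ∈ S → v ∈ S → addV F u v ∈ S
      scaleV∈ : ∀ c {u} → u ∈ S → scaleV F c u ∈ S

    lincomb∈ : ∀ {k} {b : Vec (Vector F N) k} → VecAll.All (_∈ S) b → ∀ c → lincomb F c b ∈ S
    lincomb∈ []          []       = zero∈
    lincomb∈ (v∈S ∷ b∈S) (c ∷ cs) = addV∈ (scaleV∈ c v∈S) (lincomb∈ b∈S cs)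

  isSubspace⇒IsSubspace : ∀ {N} {S : List (Vector F N)} → T (isSubspace F S) → IsSubspace S
  isSubspace⇒IsSubspace {S = S} isSub with Equivalence.to T-∧ isSub
  ... | zero∈ , closed with Equivalence.to T-∧ closed
  ...   | add-closed , scale-closed = record
    { zero∈   = memb⇒∈ zero∈
    ; addV∈   = λ u∈S v∈S → memb⇒∈ (ListAll.lookup (all⁺ _ _ (ListAll.lookup (all⁺ _ _ add-closed) u∈S)) v∈S)
    ; scaleV∈ = λ c u∈S → memb⇒∈ (ListAll.lookup (all⁺ _ _ (ListAll.lookup (all⁺ _ _ scale-closed) (∈-elems c))) u∈S)
    }

  IsSubspace⇒isSubspace : ∀ {N} {S : List (Vector F N)} → IsSubspace S → T (isSubspace F S)
  IsSubspace⇒isSubspace sub = Equivalence.from T-∧ (∈⇒memb zero∈ , Equivalence.from T-∧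
    ( all⁻ _ (ListAll.tabulate λ u∈S → all⁻ _ (ListAll.tabulate λ v∈S → ∈⇒memb (addV∈ u∈S v∈S)))
    , all⁻ _ (ListAll.tabulate {xs = elems F} λ {c} _ → all⁻ _ (ListAll.tabulate λ u∈S → ∈⇒memb (scaleV∈ c u∈S)))))
    where open IsSubspace sub

  record Basis {N} (k : ℕ) (S : List (Vector F N)) : Set where
    field
      vectors     : Vec (Vector F N) k
      vectors∈    : VecAll.All (_∈ S) vectors
      independent : Independent vectors
      spanning    : ∀ {u} → u ∈ S → u ∈Span vectors

  hasDim⇒Basis : ∀ {N k} {S : List (Vector F N)} → T (hasDim F k S) → Basis k S
  hasDim⇒Basis {k = k} {S} dim with find (any⁻ _ _ dim)
  ... | b , b∈tuples , indep∧spans with Equivalence.to T-∧ indep∧spans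
  ...   | indep , spans = record
    { vectors     = b
    ; vectors∈    = ∈-tuples⁻ b∈tuples
    ; independent = linIndep⇒Independent indep
    ; spanning    = λ {u} u∈S →
        let c , _ , cb==u = find (any⁻ (λ c → eqV F (lincomb F c b) u) (allVecs F k) (ListAll.lookup (all⁺ _ S spans) u∈S))
        in c , eqV⇒≡ cb==u
    }

  Basis⇒hasDim : ∀ {N k} {S : List (Vector F N)} → Basis k S → T (hasDim F k S)
  Basis⇒hasDim basis = any⁺ _ (lose (∈-tuples⁺ vectors∈) (Equivalence.from T-∧
    ( Independent⇒linIndep independent
    , all⁻ _ (ListAll.tabulate λ u∈S → let c , cb≡u = spanning u∈S in any⁺ _ (lose (∈-allVecs c) (≡⇒eqV cb≡u))))))
    where open Basis basis

  IsSubspaceOfDim : ∀ {N} → ℕ → List (Vector F N) → Set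
  IsSubspaceOfDim j S = IsSubspace S × Basis j S

  isSubspaceOfDim⇔ : ∀ {N j} {S : List (Vector F N)} → T (isSubspace F S ∧ hasDim F j S) ⇔ IsSubspaceOfDim j S
  isSubspaceOfDim⇔ = mk⇔
    (λ t → let sub , dim = Equivalence.to T-∧ t in isSubspace⇒IsSubspace sub , hasDim⇒Basis dim)
    (λ { (sub , basis) → Equivalence.from T-∧ (IsSubspace⇒isSubspace sub , Basis⇒hasDim basis) })

  ∈Gr⇒IsSubspaceOfDim : ∀ {N j S} → S ∈ Gr F N j → IsSubspaceOfDim j S
  ∈Gr⇒IsSubspaceOfDim {N} {j} S∈Gr =
    Equivalence.to isSubspaceOfDim⇔ (proj₂ (∈-filter⁻ (T? ∘ λ S → isSubspace F S ∧ hasDim F j S) {xs = sublists (allVecs F N)} S∈Gr))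

  _≟_ : DecidableEquality Carrier
  x ≟ y = map′ eqF⇒≡ (λ { refl → eqF-refl x }) (T? (eqF F x y))

  inSpan : ∀ {N k} → Vec (Vector F N) k → Vector F N → Bool
  inSpan {k = k} b u = any (λ c → eqV F (lincomb F c b) u) (allVecs F k)

  inSpan⇔∈Span : ∀ {N k} {b : Vec (Vector F N) k} {u} → T (inSpan b u) ⇔ u ∈Span b
  inSpan⇔∈Span {k = k} {b} {u} = mk⇔
    (λ t → let c , _ , cb==u = find (any⁻ _ (allVecs F k) t) in c , eqV⇒≡ cb==u)
    (λ { (c , cb≡u) → any⁺ _ (lose (∈-allVecs c) (≡⇒eqV cb≡u)) })

  lincomb-unit : ∀ {N k} (b : Vec (Vector F N) k) → VecAll.All (_∈Span b) b
  lincomb-unit []          = []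
  lincomb-unit {k = suc k} (v ∷ b) = (1# ∷ zeroV F k , v≡) ∷ VecAll.map shift (lincomb-unit b)
    where
    v≡ : addV F (scaleV F 1# v) (lincomb F (zeroV F k) b) ≡ v
    v≡ = trans (cong₂ (addV F) (scaleV-identityˡ v) (lincomb-zeroˡ b)) (addV-identityʳ v)
    shift : ∀ {u} → u ∈Span b → u ∈Span (v ∷ b)
    shift (c , cb≡u) = 0# ∷ c , trans (cong (λ z → addV F z (lincomb F c b)) (scaleV-zeroˡ v)) (trans (addV-identityˡ _) cb≡u)

  span-IsSubspaceOfDim : ∀ {N k} {b : Vec (Vector F N) k} {S} → Independent b →
                         (∀ {u} → u ∈ S ⇔ u ∈Span b) → IsSubspaceOfDim k S
  span-IsSubspaceOfDim {k = k} {b} {S} independent S≐span = subspace , basis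
    where
    from : ∀ {u} → u ∈Span b → u ∈ S
    from = Equivalence.from S≐span
    subspace : IsSubspace S
    subspace = record
      { zero∈   = from (zeroV F k , lincomb-zeroˡ b)
      ; addV∈   = λ u∈S v∈S → let (c , cb≡u) = Equivalence.to S≐span u∈S ; (d , db≡v) = Equivalence.to S≐span v∈S
                              in from (addV F c d , trans (lincomb-addV c d b) (cong₂ (addV F) cb≡u db≡v))
      ; scaleV∈ = λ a u∈S → let (c , cb≡u) = Equivalence.to S≐span u∈S
                            in from (scaleV F a c , trans (lincomb-scaleV a c b) (cong (scaleV F a) cb≡u))
      }
    basis : Basis k S
    basis = record
      { vectors     = b
      ; vectors∈    = VecAll.map from (lincomb-unit b)
      ; independent = independent
      ; spanning    = Equivalence.to S≐span
      }

  -- c ↦ lincomb F c b is a bijection from Carrier^j onto S.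
  count-subspace : ∀ {N j} {S : List (Vector F N)} → IsSubspaceOfDim j S → count (λ u → memb F u S) (allVecs F N) ≡ q ^ j
  count-subspace {N} {j} {S} (subspace , basis) = begin
    count (λ u → memb F u S) (allVecs F N)
      ≡⟨ sumBy-cong (allVecs F N) (λ {u} _ → sym (coordinates u)) ⟩
    sumBy (λ u → count (λ c → eqV F (lincomb F c b) u) (allVecs F j)) (allVecs F N)
      ≡⟨ sym (sumBy-swap (λ c u → indicator (eqV F (lincomb F c b) u)) (allVecs F j) (allVecs F N)) ⟩
    sumBy (λ c → count (eqV F (lincomb F c b)) (allVecs F N)) (allVecs F j) ≡⟨ sumBy-cong (allVecs F j) (λ {c} _ → image c) ⟩
    sumBy (λ _ → 1) (allVecs F j)                                           ≡⟨ sumBy-const 1 (allVecs F j) ⟩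
    length (allVecs F j) ℕ.* 1                                              ≡⟨ ℕ.*-identityʳ _ ⟩
    length (allVecs F j)                                                    ≡⟨ length-allVecs j ⟩
    q ^ j                                                                   ∎
    where
    open ≡-Reasoning
    open IsSubspace subspace
    open Basis basis renaming (vectors to b)
    image : ∀ c → count (eqV F (lincomb F c b)) (allVecs F N) ≡ 1
    image c = count-unique (allVecs-unique N) (∈-allVecs (lincomb F c b)) (λ _ → mk⇔ (sym ∘ eqV⇒≡) (≡⇒eqV ∘ sym))
    coordinates : ∀ u → count (λ c → eqV F (lincomb F c b) u) (allVecs F j) ≡ indicator (memb F u S)
    coordinates u with memb F u S in u∈?S
    ... | true  = let c , cb≡u = spanning (memb⇒∈ (subst T (sym u∈?S) _)) in
      count-unique (allVecs-unique j) (∈-allVecs c)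
        (λ _ → mk⇔ (λ c′b==u → lincomb-injective independent (trans (eqV⇒≡ c′b==u) (sym cb≡u))) (λ { refl → ≡⇒eqV cb≡u }))
    ... | false = count-none _ (allVecs F j) λ {c} _ cb==u →
      subst T u∈?S (∈⇒memb (subst (_∈ S) (eqV⇒≡ cb==u) (lincomb∈ vectors∈ c)))

  nonzero : ∀ {N} → Vector F N → Bool
  nonzero {N} v = not (eqV F v (zeroV F N))

  count-nonzero : ∀ {N} (χ : Vector F N → Bool) → T (χ (zeroV F N)) →
                  1 ℕ.+ count (λ v → χ v ∧ nonzero v) (allVecs F N) ≡ count χ (allVecs F N)
  count-nonzero {N} χ χ0 = begin
    1 ℕ.+ count (λ v → χ v ∧ nonzero v) (allVecs F N)
      ≡⟨ cong (ℕ._+ count (λ v → χ v ∧ nonzero v) (allVecs F N)) (sym just-zero) ⟩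
    count (λ v → χ v ∧ eqV F v (zeroV F N)) (allVecs F N) ℕ.+ count (λ v → χ v ∧ nonzero v) (allVecs F N)
      ≡⟨ sym (count-split χ (λ v → eqV F v (zeroV F N)) (allVecs F N)) ⟩
    count χ (allVecs F N)                                             ∎
    where
    open ≡-Reasoning
    just-zero : count (λ v → χ v ∧ eqV F v (zeroV F N)) (allVecs F N) ≡ 1
    just-zero = count-unique (allVecs-unique N) (∈-allVecs (zeroV F N)) λ _ → mk⇔
      (eqV⇒≡ ∘ proj₂ ∘ Equivalence.to T-∧)
      (λ { refl → Equivalence.from T-∧ (χ0 , ≡⇒eqV {u = zeroV F N} refl) })

  lincomb-singleton : ∀ {N} c (v : Vector F N) → lincomb F (c ∷ []) (v ∷ []) ≡ scaleV F c v
  lincomb-singleton c v = addV-identityʳ (scaleV F c v)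

  singleton-independent : ∀ {N} {v : Vector F N} → v ≢ zeroV F N → Independent (v ∷ [])
  singleton-independent {v = v} v≢0 (c ∷ []) cv≡0 with c ≟ 0#
  ... | yes c≡0 = cong (_∷ []) c≡0
  ... | no  c≢0 = ⊥-elim (v≢0 (scaleV-cancelˡ-zero c≢0 (trans (sym (lincomb-singleton c v)) cv≡0)))

  ∈Span-rebase : ∀ {N} {b u v : Vector F N} → v ∈Span (b ∷ []) → v ≢ zeroV F N → u ∈Span (b ∷ []) → u ∈Span (v ∷ [])
  ∈Span-rebase {b = b} {u} {v} (c ∷ [] , cb≡v) v≢0 (e ∷ [] , eb≡u) with c ≟ 0#
  ... | yes refl = ⊥-elim (v≢0 (trans (sym cb≡v) (trans (lincomb-singleton 0# b) (scaleV-zeroˡ b))))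
  ... | no  c≢0 with invertible c c≢0
  ...   | c⁻¹ , cc⁻¹≡1 = (e * c⁻¹) ∷ [] , (begin
    lincomb F ((e * c⁻¹) ∷ []) (v ∷ [])   ≡⟨ lincomb-singleton (e * c⁻¹) v ⟩
    scaleV F (e * c⁻¹) v                  ≡⟨ cong (scaleV F (e * c⁻¹)) (trans (sym cb≡v) (lincomb-singleton c b)) ⟩
    scaleV F (e * c⁻¹) (scaleV F c b)     ≡⟨ sym (scaleV-assoc (e * c⁻¹) c b) ⟩
    scaleV F ((e * c⁻¹) * c) b            ≡⟨ cong (λ a → scaleV F a b) ec⁻¹c≡e ⟩
    scaleV F e b                          ≡⟨ trans (sym (lincomb-singleton e b)) eb≡u ⟩
    u                                     ∎)
    where
    open ≡-Reasoning
    ec⁻¹c≡e : (e * c⁻¹) * c ≡ e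
    ec⁻¹c≡e = trans (*-assoc e c⁻¹ c) (trans (cong (e *_) (trans (*-comm c⁻¹ c) cc⁻¹≡1)) (*-identityʳ e))

  line-spannedBy : ∀ {N} {p : List (Vector F N)} {u v} → IsSubspaceOfDim 1 p →
                   v ∈ p → v ≢ zeroV F N → u ∈ p → u ∈Span (v ∷ [])
  line-spannedBy (_ , record { vectors = _ ∷ [] ; spanning = spanning }) v∈p v≢0 u∈p =
    ∈Span-rebase (spanning v∈p) v≢0 (spanning u∈p)

  -- The line through v is the only sublist of allVecs F N whose members are the multiples of v.
  count-lines-∋ : ∀ {N} {v : Vector F N} → v ≢ zeroV F N → count (memb F v) (Gr F N 1) ≡ 1
  count-lines-∋ {N} {v} v≢0 =
    trans (count-filterᵇ (memb F v) isLine (sublists (allVecs F N)))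
          (count-sublists-selectedBy (inSpan (v ∷ [])) _ (allVecs-unique N) (λ _ → mk⇔ to from))
    where
    isLine : List (Vector F N) → Bool
    isLine S = isSubspace F S ∧ hasDim F 1 S
    v∈Span : v ∈Span (v ∷ [])
    v∈Span = 1# ∷ [] , trans (lincomb-singleton 1# v) (scaleV-identityˡ v)
    to : ∀ {S} → T (isLine S ∧ memb F v S) → SelectedBy (inSpan (v ∷ [])) (allVecs F N) S
    to {S} t _ = mk⇔
      (λ u∈S → Equivalence.from inSpan⇔∈Span (line-spannedBy line v∈S v≢0 u∈S))
      (λ u∈?span → let c , cv≡u = Equivalence.to inSpan⇔∈Span u∈?span
                   in subst (_∈ S) cv≡u (IsSubspace.lincomb∈ (proj₁ line) (v∈S ∷ []) c))
      where
      line : IsSubspaceOfDim 1 S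
      line = Equivalence.to isSubspaceOfDim⇔ (proj₁ (Equivalence.to T-∧ t))
      v∈S : v ∈ S
      v∈S = memb⇒∈ (proj₂ (Equivalence.to T-∧ t))
    from : ∀ {S} → SelectedBy (inSpan (v ∷ [])) (allVecs F N) S → T (isLine S ∧ memb F v S)
    from {S} selected = Equivalence.from T-∧
      ( Equivalence.from isSubspaceOfDim⇔ (span-IsSubspaceOfDim (singleton-independent v≢0) S≐span)
      , ∈⇒memb (Equivalence.from S≐span v∈Span))
      where
      S≐span : ∀ {u} → u ∈ S ⇔ u ∈Span (v ∷ [])
      S≐span {u} = ⇔-trans (selected (∈-allVecs u)) inSpan⇔∈Span

  nonzero⇒≢0 : ∀ {N} {v : Vector F N} → T (nonzero v) → v ≢ zeroV F N
  nonzero⇒≢0 {v = v} v≠0 refl = subst T (Equivalence.to T-not-≡ v≠0) (≡⇒eqV {u = v} refl)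

  count-nonzero-line : ∀ {N} {p : List (Vector F N)} → IsSubspaceOfDim 1 p →
                       count (λ v → memb F v p ∧ nonzero v) (allVecs F N) ≡ q ℕ.∸ 1
  count-nonzero-line {N} {p} line = begin
    count (λ v → memb F v p ∧ nonzero v) (allVecs F N)     ≡⟨⟩
    1 ℕ.+ count (λ v → memb F v p ∧ nonzero v) (allVecs F N) ℕ.∸ 1
      ≡⟨ cong (ℕ._∸ 1) (trans (count-nonzero (λ v → memb F v p) (∈⇒memb (IsSubspace.zero∈ (proj₁ line)))) (count-subspace line)) ⟩
    q ℕ.* 1 ℕ.∸ 1                                          ≡⟨ cong (ℕ._∸ 1) (ℕ.*-identityʳ q) ⟩
    q ℕ.∸ 1                                                ∎
    where open ≡-Reasoning

  count-lines-within : ∀ {N} (χ : Vector F N → Bool) → (∀ c {u} → T (χ u) → T (χ (scaleV F c u))) →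
                       (q ℕ.∸ 1) ℕ.* count (all χ) (Gr F N 1) ≡ count (λ v → χ v ∧ nonzero v) (allVecs F N)
  count-lines-within {N} χ χ-cone = begin
    (q ℕ.∸ 1) ℕ.* count (all χ) lines                          ≡⟨ sumBy-*ˡ (q ℕ.∸ 1) (indicator ∘ all χ) lines ⟨
    sumBy (λ p → (q ℕ.∸ 1) ℕ.* indicator (all χ p)) lines      ≡⟨ sumBy-cong lines (λ {p} p∈ → sym (on-line p p∈)) ⟩
    sumBy (λ p → count (λ v → (χ v ∧ nonzero v) ∧ memb F v p) vectors) lines
      ≡⟨ sumBy-swap (λ v p → indicator ((χ v ∧ nonzero v) ∧ memb F v p)) vectors lines ⟨
    sumBy (λ v → count (λ p → (χ v ∧ nonzero v) ∧ memb F v p) lines) vectors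
      ≡⟨ sumBy-cong vectors (λ {v} _ → through-vector v) ⟩
    count (λ v → χ v ∧ nonzero v) vectors                      ∎
    where
    open ≡-Reasoning
    lines : List (List (Vector F N))
    lines = Gr F N 1
    vectors : List (Vector F N)
    vectors = allVecs F N
    through-vector : ∀ v → count (λ p → (χ v ∧ nonzero v) ∧ memb F v p) lines ≡ indicator (χ v ∧ nonzero v)
    through-vector v with χ v ∧ nonzero v in χv∧v≠0
    ... | true  = count-lines-∋ {v = v} (nonzero⇒≢0 {v = v} (proj₂ (Equivalence.to (T-∧ {χ v}) (subst T (sym χv∧v≠0) _))))
    ... | false = count-none (λ p → false ∧ memb F v p) lines (λ _ ())
    on-line : ∀ p → p ∈ lines → count (λ v → (χ v ∧ nonzero v) ∧ memb F v p) vectors ≡ (q ℕ.∸ 1) ℕ.* indicator (all χ p)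
    on-line p p∈lines with all χ p in p⊆χ
    ... | true  =
      trans (count-cong vectors (λ {v} _ → mk⇔ (reorder {v}) (reorder′ {v} ∘ Equivalence.to (T-∧ {memb F v p}))))
            (trans (count-nonzero-line line) (sym (ℕ.*-identityʳ _)))
      where
      line : IsSubspaceOfDim 1 p
      line = ∈Gr⇒IsSubspaceOfDim p∈lines
      reorder : ∀ {v} → T ((χ v ∧ nonzero v) ∧ memb F v p) → T (memb F v p ∧ nonzero v)
      reorder {v} t = let χv∧v≠0 , v∈p = Equivalence.to (T-∧ {χ v ∧ nonzero v}) t
                      in Equivalence.from (T-∧ {memb F v p}) (v∈p , proj₂ (Equivalence.to (T-∧ {χ v}) χv∧v≠0))
      reorder′ : ∀ {v} → T (memb F v p) × T (nonzero v) → T ((χ v ∧ nonzero v) ∧ memb F v p)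
      reorder′ {v} (v∈p , v≠0) = Equivalence.from (T-∧ {χ v ∧ nonzero v})
        (Equivalence.from (T-∧ {χ v}) (ListAll.lookup (all⁺ χ p (subst T (sym p⊆χ) _)) (memb⇒∈ v∈p) , v≠0) , v∈p)
    ... | false = trans (count-none (λ v → (χ v ∧ nonzero v) ∧ memb F v p) vectors λ _ t → subst T p⊆χ (p⊆χ-from t))
                        (sym (ℕ.*-zeroʳ (q ℕ.∸ 1)))
      where
      χ-span : ∀ {u v} → T (χ v) → u ∈Span (v ∷ []) → T (χ u)
      χ-span {v = v} χv (c ∷ [] , cv≡u) = subst (T ∘ χ) (trans (sym (lincomb-singleton c v)) cv≡u) (χ-cone c χv)
      p⊆χ-from : ∀ {v} → T ((χ v ∧ nonzero v) ∧ memb F v p) → T (all χ p)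
      p⊆χ-from {v} t =
        let χv∧v≠0 , v∈p = Equivalence.to (T-∧ {χ v ∧ nonzero v}) t
            χv , v≠0 = Equivalence.to (T-∧ {χ v}) χv∧v≠0
        in all⁻ χ (ListAll.tabulate λ u∈p →
             χ-span χv (line-spannedBy (∈Gr⇒IsSubspaceOfDim p∈lines) (memb⇒∈ v∈p) (nonzero⇒≢0 v≠0) u∈p))

  standardBasis : ∀ {N k} → k ℕ.≤ N → Vec (Vector F N) k
  standardBasis {k = zero}          _           = []
  standardBasis {suc N} {suc k} (ℕ.s≤s k≤N) = (1# ∷ zeroV F N) ∷ Vec.map (0# ∷_) (standardBasis k≤N)

  lincomb-map-0∷ : ∀ {N k} (c : Vec Carrier k) (b : Vec (Vector F N) k) → lincomb F c (Vec.map (0# ∷_) b) ≡ 0# ∷ lincomb F c b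
  lincomb-map-0∷ []       []      = refl
  lincomb-map-0∷ (c ∷ cs) (v ∷ b) =
    trans (cong (addV F (scaleV F c (0# ∷ v))) (lincomb-map-0∷ cs b))
          (cong (_∷ addV F (scaleV F c v) (lincomb F cs b)) (trans (cong (_+ 0#) (zeroʳ c)) (+-identityˡ 0#)))

  standardBasis-independent : ∀ {N k} (k≤N : k ℕ.≤ N) → Independent (standardBasis k≤N)
  standardBasis-independent {k = zero}        _           []       _     = refl
  standardBasis-independent {suc N} {suc k} (ℕ.s≤s k≤N) (c ∷ cs) cb≡0 = cong₂ _∷_ c≡0 (standardBasis-independent k≤N cs rest≡0)
    where
    expand : lincomb F (c ∷ cs) (standardBasis (ℕ.s≤s k≤N))
             ≡ ((c * 1#) + 0#) ∷ addV F (scaleV F c (zeroV F N)) (lincomb F cs (standardBasis k≤N))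
    expand = cong (addV F (scaleV F c (1# ∷ zeroV F N))) (lincomb-map-0∷ cs (standardBasis k≤N))
    c≡0 : c ≡ 0#
    c≡0 = trans (sym (*-identityʳ c)) (trans (sym (+-identityʳ _)) (cong Vec.head (trans (sym expand) cb≡0)))
    rest≡0 : lincomb F cs (standardBasis k≤N) ≡ zeroV F N
    rest≡0 = trans (sym (trans (cong (λ z → addV F z _) (scaleV-zeroʳ c)) (addV-identityˡ _)))
                   (cong Vec.tail (trans (sym expand) cb≡0))

  Gr-nonEmpty : ∀ {N k} → k ℕ.≤ N → ℕ.NonZero (length (Gr F N k))
  Gr-nonEmpty {N} {k} k≤N = ∈⇒nonZero-length
    (∈-filter⁺ (T? ∘ λ S → isSubspace F S ∧ hasDim F k S) (filterᵇ∈sublists (inSpan b) (allVecs F N))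
      (Equivalence.from isSubspaceOfDim⇔ (span-IsSubspaceOfDim (standardBasis-independent k≤N) span≐)))
    where
    b : Vec (Vector F N) k
    b = standardBasis k≤N
    span≐ : ∀ {u} → u ∈ List.filterᵇ (inSpan b) (allVecs F N) ⇔ u ∈Span b
    span≐ {u} = mk⇔
      (Equivalence.to inSpan⇔∈Span ∘ proj₂ ∘ ∈-filter⁻ (T? ∘ inSpan b) {xs = allVecs F N})
      (∈-filter⁺ (T? ∘ inSpan b) (∈-allVecs u) ∘ Equivalence.from inSpan⇔∈Span)

open Counting
open Mean

module _ (F : FiniteField) where
  open FiniteField F using (q)
  open LinearAlgebra F

  suc-*-count-lines : ∀ N → suc ((q ∸ 1) ℕ.* count (const true) (Gr F N 1)) ≡ q ^ N
  suc-*-count-lines N = begin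
    suc ((q ∸ 1) ℕ.* count (const true) (Gr F N 1))     ≡⟨ cong (λ n → suc ((q ∸ 1) ℕ.* n)) all-lines ⟩
    suc ((q ∸ 1) ℕ.* count (all (const true)) (Gr F N 1))
      ≡⟨ cong suc (count-lines-within {N} (const true) (λ _ _ → _)) ⟩
    suc (count (λ v → true ∧ nonzero v) (allVecs F N))  ≡⟨ count-nonzero {N} (const true) _ ⟩
    count (const true) (allVecs F N)                      ≡⟨ count-true (allVecs F N) ⟩
    length (allVecs F N)                                  ≡⟨ length-allVecs N ⟩
    q ^ N                                                 ∎
    where
    open ≡-Reasoning
    all-lines : count (const true) (Gr F N 1) ≡ count (all (const true)) (Gr F N 1)
    all-lines = count-cong (Gr F N 1) (λ {p} _ → mk⇔ (λ _ → all⁻ (const true) (ListAll.tabulate {xs = p} (λ _ → _))) (λ _ → _))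

  suc-*-count-lines-⊆ : ∀ {N k V} → V ∈ Gr F N k → suc ((q ∸ 1) ℕ.* count (λ p → contained F p V) (Gr F N 1)) ≡ q ^ k
  suc-*-count-lines-⊆ {N} {k} {V} V∈Gr = begin
    suc ((q ∸ 1) ℕ.* count (λ p → contained F p V) (Gr F N 1))
      ≡⟨ cong suc (count-lines-within (λ u → memb F u V) (λ c {u} → ∈⇒memb ∘′ IsSubspace.scaleV∈ (proj₁ V-sub) c {u} ∘′ memb⇒∈)) ⟩
    suc (count (λ v → memb F v V ∧ nonzero v) (allVecs F N))
      ≡⟨ count-nonzero (λ u → memb F u V) (∈⇒memb (IsSubspace.zero∈ (proj₁ V-sub))) ⟩
    count (λ u → memb F u V) (allVecs F N)                ≡⟨ count-subspace V-sub ⟩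
    q ^ k                                                 ∎
    where
    open ≡-Reasoning
    V-sub : IsSubspaceOfDim k V
    V-sub = ∈Gr⇒IsSubspaceOfDim V∈Gr

  numOutside≡count-lines-⊈ : ∀ {N k V} → V ∈ Gr F N k → numOutside F N k ≡ count (λ p → not (contained F p V)) (Gr F N 1)
  numOutside≡count-lines-⊈ {N} {k} {V} V∈Gr =
    trans (cong (λ n → (n / (q ∸ 1)) {{q-1-nonZero F}}) q^N-q^k≡) (m*n/n≡m outside (q ∸ 1) {{q-1-nonZero F}})
    where
    lines within outside : ℕ
    lines   = count (const true) (Gr F N 1)
    within  = count (λ p → contained F p V) (Gr F N 1)
    outside = count (λ p → not (contained F p V)) (Gr F N 1)
    q^N-q^k≡ : q ^ N ∸ q ^ k ≡ outside ℕ.* (q ∸ 1)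
    q^N-q^k≡ = begin
      q ^ N ∸ q ^ k                                   ≡⟨ cong₂ _∸_ (suc-*-count-lines N) (suc-*-count-lines-⊆ {N} {k} V∈Gr) ⟨
      suc ((q ∸ 1) ℕ.* lines) ∸ suc ((q ∸ 1) ℕ.* within) ≡⟨⟩
      (q ∸ 1) ℕ.* lines ∸ (q ∸ 1) ℕ.* within          ≡⟨ ℕ.*-distribˡ-∸ (q ∸ 1) lines within ⟨
      (q ∸ 1) ℕ.* (lines ∸ within)
        ≡⟨ cong (λ n → (q ∸ 1) ℕ.* (n ∸ within)) (count-split (const true) (λ p → contained F p V) (Gr F N 1)) ⟩
      (q ∸ 1) ℕ.* (within ℕ.+ outside ∸ within)       ≡⟨ cong ((q ∸ 1) ℕ.*_) (ℕ.m+n∸m≡n within outside) ⟩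
      (q ∸ 1) ℕ.* outside                             ≡⟨ ℕ.*-comm (q ∸ 1) outside ⟩
      outside ℕ.* (q ∸ 1)                             ∎
      where open ≡-Reasoning

  count-pointSets-distinguishedBy : ∀ {N k V} ℓ → V ∈ Gr F N k →
                                    count (distinguishes F V) (pointSets F N ℓ) ≡ numOutside F N k C ℓ
  count-pointSets-distinguishedBy {N} {k} {V} ℓ V∈Gr = begin
    count (distinguishes F V) (pointSets F N ℓ)
      ≡⟨ count-filterᵇ (distinguishes F V) (λ P → length P ℕ.≡ᵇ ℓ) (sublists (Gr F N 1)) ⟩
    count (λ P → (length P ℕ.≡ᵇ ℓ) ∧ distinguishes F V P) (sublists (Gr F N 1))
      ≡⟨ count-sublists-all (λ p → not (contained F p V)) (Gr F N 1) ℓ ⟩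
    count (λ p → not (contained F p V)) (Gr F N 1) C ℓ
      ≡⟨ cong (_C ℓ) (numOutside≡count-lines-⊈ {N} {k} V∈Gr) ⟨
    numOutside F N k C ℓ ∎
    where open ≡-Reasoning

  sum-count-distinguishing : ∀ N k ℓ →
    sumBy (λ P → length (filterᵇ (λ V → distinguishes F V P) (Gr F N k))) (pointSets F N ℓ)
      ≡ (numOutside F N k C ℓ) ℕ.* length (Gr F N k)
  sum-count-distinguishing N k ℓ = begin
    sumBy (λ P → length (filterᵇ (λ V → distinguishes F V P) G)) (pointSets F N ℓ)
      ≡⟨ sumBy-cong (pointSets F N ℓ) (λ {P} _ → length-filterᵇ (λ V → distinguishes F V P) G) ⟩
    sumBy (λ P → count (λ V → distinguishes F V P) G) (pointSets F N ℓ)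
      ≡⟨ sumBy-swap (λ P V → indicator (distinguishes F V P)) (pointSets F N ℓ) G ⟩
    sumBy (λ V → count (distinguishes F V) (pointSets F N ℓ)) G
      ≡⟨ sumBy-cong G (count-pointSets-distinguishedBy {N} {k} ℓ) ⟩
    sumBy (const (numOutside F N k C ℓ)) G            ≡⟨ sumBy-const _ G ⟩
    length G ℕ.* (numOutside F N k C ℓ)               ≡⟨ ℕ.*-comm (length G) (numOutside F N k C ℓ) ⟩
    (numOutside F N k C ℓ) ℕ.* length G               ∎
    where
    open ≡-Reasoning
    G : List (List (Vector F N))
    G = Gr F N k

theorem4p3 : (F : FiniteField) (N k ℓ : ℕ) →
    3 ≤ N → 1 ≤ k → k ≤ N ∸ 1 → 1 ≤ ℓ → ℓ ≤ numPoints F N →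
    δ̂ F N k ℓ ≡ frac (numOutside F N k C ℓ) (numPoints F N C ℓ)
theorem4p3 F N k ℓ _ _ k≤N-1 _ _ =
  mean-frac (λ P → length (filterᵇ (λ V → distinguishes F V P) (Gr F N k)))
            (numOutside F N k C ℓ) (length (Gr F N k)) (numPoints F N C ℓ) (pointSets F N ℓ)
            {{LinearAlgebra.Gr-nonEmpty F (ℕ.≤-trans k≤N-1 (ℕ.m∸n≤m N 1))}}
            (sum-count-distinguishing F N k ℓ)
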